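{- (1) If $\sigma$ is a pattern of $\tau$ and $\tau\in B_k^{(rd)}$, then $\sigma\in B_k^{(rd)}$. (2) If $\sigma^{\varepsilon_s}$ is a pattern of $\tau^{\varepsilon_t}$ in the peg pattern order and $\tau^{\varepsilon_t}\in\hat B_k^{(rd)}$, then $\sigma^{\varepsilon_s}\in \hat B_k^{(rd)}$.
   Context: Permutations are in one-line notation; $\sigma$ is a pattern of $\tau$ if some subsequence of $\tau$ is order-isomorphic to $\sigma$. A reversal of a permutation replaces a factor $\pi_i\cdots\pi_j$ by $\pi_j\cdots\pi_i$; $rd(\pi)$ is the minimum number of reversals sorting $\pi$ to the identity; $B_k^{(rd)}$ is the set of all permutations with $rd\le k$. A peg permutation of length $n$ is a word $\pi_1^{\varepsilon_1}\cdots\pi_n^{\varepsilon_n}$ with $\pi_1\cdots\pi_n$ a permutation of $\{1,\dots,n\}$ and $\varepsilon_i\in\{+,-,\bullet\}$. A reversal of a peg permutation reverses a factor and swaps $+\leftrightarrow-$ on the reversed entries ($\bullet$ unchanged); $rd(\pi^\varepsilon)$ is the minimum number of such reversals turning $\pi^\varepsilon$ into a peg permutation with identity underlying permutation and all decorations in $\{+,\bullet\}$; $\hat B_k^{(rd)}$ is the set of peg permutations with $rd\le k$. Peg pattern order: $\sigma^\delta$ of length $m$ is a pattern of $\tau^\varepsilon$ if there are $i_1<\dots<i_m$ with $\tau_{i_1}\cdots\tau_{i_m}$ order-isomorphic to $\sigma$ and, for each $j$, $\delta_j\in\{+,-\}$ implies $\varepsilon_{i_j}=\delta_j$ (e.g.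 $1^+2^\bullet3^+$ is a pattern of $1^+2^-3^+$). -}

module Defs where

open import Data.Nat using (ℕ; zero; suc; _≤_; _<_; _∸_)
open import Data.List using (List; []; _∷_; _++_; take; drop; reverse; map; length; upTo)
open import Data.List.Relation.Unary.All using (All)
open import Data.List.Relation.Binary.Pointwise using (Pointwise)
open import Data.List.Relation.Binary.Sublist.Propositional using (_⊆_)
open import Data.List.Relation.Binary.Permutation.Propositional using (_↭_)
open import Data.Product using (_×_; _,_; proj₁; proj₂; ∃; ∃-syntax)
open import Relation.Binary.PropositionalEquality using (_≡_; _≢_)
open import Function.Bundles using (_⇔_)

-- Permutations in one-line notation, as lists of values 1..n

idPerm : ℕ → List ℕ
idPerm n = map suc (upTo n)

IsPerm : List ℕ → Set
IsPerm xs = xs ↭ idPerm (length xs)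

-- Reverse the factor at (0-based) positions i..j (inclusive) of a word,
-- applying f to each reversed entry.
revFactorWith : {A : Set} → (A → A) → ℕ → ℕ → List A → List A
revFactorWith f i j xs =
  take i xs ++ reverse (map f (take (suc (j ∸ i)) (drop i xs))) ++ drop (suc j) xs

revFactor : {A : Set} → ℕ → ℕ → List A → List A
revFactor = revFactorWith (λ x → x)

-- Generic "can be sorted with at most k reversals":
-- Sortable rev sorted k w  means there are at most k reversals (factor i..j
-- with i ≤ j < length w) turning w into a word satisfying `sorted`.
data Sortable {A : Set} (rv : ℕ → ℕ → List A → List A) (sorted : List A → Set)
     : ℕ → List A → Set where
  done : ∀ {k w} → sorted w → Sortable rv sorted k w
  step : ∀ {k w} (i j : ℕ) → i ≤ j → j < length w →
         Sortable rv sorted k (rv i j w) → Sortable rv sorted (suc k) w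

data OrdIso : List ℕ → List ℕ → Set where
  []  : OrdIso [] []
  _∷_ : ∀ {x y xs ys} →
        Pointwise (λ x' y' → ((x < x') ⇔ (y < y')) × ((x' < x) ⇔ (y' < y))) xs ys →
        OrdIso xs ys → OrdIso (x ∷ xs) (y ∷ ys)

IsPattern : List ℕ → List ℕ → Set
IsPattern σ τ = ∃[ ρ ] (ρ ⊆ τ × OrdIso σ ρ)

InB : ℕ → List ℕ → Set
InB k π = Sortable revFactor (λ w → w ≡ idPerm (length w)) k π

data Deco : Set where
  plus minus dot : Deco

flip : Deco → Deco
flip plus  = minus
flip minus = plus
flip dot   = dot

Peg : Set
Peg = List (ℕ × Deco)

IsPegPerm : Peg → Set
IsPegPerm p = IsPerm (map proj₁ p)

revPeg : ℕ → ℕ → Peg → Peg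
revPeg = revFactorWith (λ { (v , d) → (v , flip d) })

PegSorted : Peg → Set
PegSorted p = (map proj₁ p ≡ idPerm (length p)) × All (λ e → proj₂ e ≢ minus) p

InBhat : ℕ → Peg → Set
InBhat k p = Sortable revPeg PegSorted k p

DecoOK : Deco → Deco → Set
DecoOK plus  ε = ε ≡ plus
DecoOK minus ε = ε ≡ minus
DecoOK dot   ε = ε ≡ ε

IsPegPattern : Peg → Peg → Set
IsPegPattern σ τ = ∃[ ρ ] (ρ ⊆ τ × OrdIso (map proj₁ σ) (map proj₁ ρ)
                         × Pointwise (λ s r → DecoOK (proj₂ s) (proj₂ r)) σ ρ)

-- Follow a sorting of τ by reversals and carry an occurrence of σ along. A reversal of τ meets the
-- occurrence in a (possibly empty) factor of it, and reversing that factor of σ's occurrence, with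
-- its pegs flipped, keeps it order-isomorphic to σ and decoration-compatible; so σ needs no more
-- reversals than τ. Once τ is the identity without minus pegs, the occurrence is increasing, hence
-- σ, a permutation order-isomorphic to it, is the identity, and its pegs are not minus either.
-- Unsigned permutations are the peg permutations all of whose pegs are •.

module Submission where

open import Data.Nat using (ℕ; suc; _+_; _∸_; _≤_; _<_; s≤s)
open import Data.Nat.Properties using (+-suc; m+[n∸m]≡n; m≤m+n; <⇒≤; ≤-totalOrder)
open import Data.List using (List; []; _∷_; _++_; take; drop; reverse; map; length; upTo)
open import Data.List.Properties
  using (map-++; map-∘; map-cong; map-id; reverse-map; take++drop≡id; drop-drop; take-map; drop-map;
         length-map; length-++; length-upTo)
open import Data.List.Relation.Unary.All using (All; []; _∷_)
import Data.List.Relation.Unary.All as All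
import Data.List.Relation.Unary.All.Properties as AllP
open import Data.List.Relation.Unary.AllPairs using (AllPairs; []; _∷_)
import Data.List.Relation.Unary.AllPairs as AllPairs
import Data.List.Relation.Unary.AllPairs.Properties as AllPairsP
open import Data.List.Relation.Unary.Sorted.TotalOrder using (Sorted)
open import Data.List.Relation.Unary.Sorted.TotalOrder.Properties using (↗↭↗⇒≋; AllPairs⇒Sorted)
open import Data.List.Relation.Binary.Pointwise using (Pointwise; []; _∷_; Pointwise-≡⇒≡)
open import Data.List.Relation.Binary.Sublist.Propositional using (_⊆_; []; _∷_; _∷ʳ_; minimum)
import Data.List.Relation.Binary.Sublist.Propositional.Properties as Sublist
open import Data.List.Relation.Binary.Permutation.Propositional
  using (_↭_; ↭-sym; ↭-trans; ↭-reflexive; ↭⇒↭ₛ)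
import Data.List.Relation.Binary.Permutation.Propositional.Properties as Perm
import Data.List.Relation.Binary.Permutation.Setoid.Properties as SetoidPerm
open import Data.Product using (_×_; _,_; proj₁; proj₂; ∃-syntax)
open import Function.Bundles using (_⇔_; Equivalence)
open import Relation.Binary.PropositionalEquality
  using (_≡_; _≢_; refl; sym; trans; cong; cong₂; subst; subst₂; resp₂; setoid; module ≡-Reasoning)
open import Defs

private
  variable
    A B E : Set
    k : ℕ

sortable-suc : ∀ {rv : ℕ → ℕ → List A → List A} {sorted : List A → Set} {w} →
               Sortable rv sorted k w → Sortable rv sorted (suc k) w
sortable-suc (done w-sorted)         = done w-sorted
sortable-suc (step i j i≤j j<∣w∣ rest) = step i j i≤j j<∣w∣ (sortable-suc rest)

take-length-++ : (xs ys : List A) → take (length xs) (xs ++ ys) ≡ xs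
take-length-++ []       ys = refl
take-length-++ (x ∷ xs) ys = cong (x ∷_) (take-length-++ xs ys)

drop-length-++ : (xs ys : List A) → drop (length xs) (xs ++ ys) ≡ ys
drop-length-++ []       ys = refl
drop-length-++ (x ∷ xs) ys = drop-length-++ xs ys

revFactorWith-++ : (f : A → A) (xs : List A) (y : A) (ys zs : List A) →
  revFactorWith f (length xs) (length xs + length ys) (xs ++ (y ∷ ys) ++ zs)
    ≡ xs ++ reverse (map f (y ∷ ys)) ++ zs
revFactorWith-++ f []       y ys zs =
  cong₂ (λ ys′ zs′ → reverse (map f (y ∷ ys′)) ++ zs′) (take-length-++ ys zs) (drop-length-++ ys zs)
revFactorWith-++ f (x ∷ xs) y ys zs = cong (x ∷_) (revFactorWith-++ f xs y ys zs)

factor-end<length : (xs : List A) (y : A) (ys zs : List A) →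
  length xs + length ys < length (xs ++ (y ∷ ys) ++ zs)
factor-end<length []       y ys zs = s≤s (subst (length ys ≤_) (sym (length-++ ys)) (m≤m+n _ _))
factor-end<length (x ∷ xs) y ys zs = s≤s (factor-end<length xs y ys zs)

-- An empty factor needs no reversal, hence the weakening.
sortable-suc-reversal : (f : A → A) {sorted : List A → Set} (xs ys zs : List A) →
  Sortable (revFactorWith f) sorted k (xs ++ reverse (map f ys) ++ zs) →
  Sortable (revFactorWith f) sorted (suc k) (xs ++ ys ++ zs)
sortable-suc-reversal f xs []       zs rest = sortable-suc rest
sortable-suc-reversal f {sorted} xs (y ∷ ys) zs rest =
  step (length xs) (length xs + length ys) (m≤m+n _ _) (factor-end<length xs y ys zs)
       (subst (Sortable (revFactorWith f) sorted _) (sym (revFactorWith-++ f xs y ys zs)) rest)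

factor-decomposition : ∀ {i j} (w : List A) → i ≤ j →
  take i w ++ take (suc (j ∸ i)) (drop i w) ++ drop (suc j) w ≡ w
factor-decomposition {i = i} {j} w i≤j = begin
    take i w ++ take n (drop i w) ++ drop (suc j) w
  ≡⟨ cong (λ m → take i w ++ take n (drop i w) ++ drop m w) (sym i+n≡1+j) ⟩
    take i w ++ take n (drop i w) ++ drop (i + n) w
  ≡⟨ cong (λ d → take i w ++ take n (drop i w) ++ d) (sym (drop-drop i n w)) ⟩
    take i w ++ take n (drop i w) ++ drop n (drop i w)
  ≡⟨ cong (take i w ++_) (take++drop≡id n (drop i w)) ⟩
    take i w ++ drop i w
  ≡⟨ take++drop≡id i w ⟩
    w ∎
  where
  open ≡-Reasoning
  n = suc (j ∸ i)
  i+n≡1+j : i + n ≡ suc j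
  i+n≡1+j = trans (+-suc i (j ∸ i)) (cong suc (m+[n∸m]≡n i≤j))

map-++₃ : (g : A → B) (xs ys zs : List A) → map g (xs ++ ys ++ zs) ≡ map g xs ++ map g ys ++ map g zs
map-++₃ g xs ys zs = trans (map-++ g xs (ys ++ zs)) (cong (map g xs ++_) (map-++ g ys zs))

map-++-reverse-map : (g : E → A) {h : E → E} {f : A → A} → (∀ e → g (h e) ≡ f (g e)) →
  (xs ys zs : List E) →
  map g (xs ++ reverse (map h ys) ++ zs) ≡ map g xs ++ reverse (map f (map g ys)) ++ map g zs
map-++-reverse-map g {h} {f} gh xs ys zs = begin
    map g (xs ++ reverse (map h ys) ++ zs)
  ≡⟨ map-++₃ g xs (reverse (map h ys)) zs ⟩
    map g xs ++ map g (reverse (map h ys)) ++ map g zs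
  ≡⟨ cong (λ m → map g xs ++ m ++ map g zs) (reverse-map g (map h ys)) ⟩
    map g xs ++ reverse (map g (map h ys)) ++ map g zs
  ≡⟨ cong (λ m → map g xs ++ reverse m ++ map g zs) commute ⟩
    map g xs ++ reverse (map f (map g ys)) ++ map g zs ∎
  where
  open ≡-Reasoning
  commute : map g (map h ys) ≡ map f (map g ys)
  commute = trans (sym (map-∘ ys)) (trans (map-cong gh ys) (map-∘ ys))

map-⊆-++⁻ : (g : E → A) (Z : List E) (xs ys : List A) → map g Z ⊆ xs ++ ys →
  ∃[ Zx ] ∃[ Zy ] Z ≡ Zx ++ Zy × map g Zx ⊆ xs × map g Zy ⊆ ys
map-⊆-++⁻ g Z       []       ys Z⊆ys = [] , Z , refl , [] , Z⊆ys
map-⊆-++⁻ g []      (x ∷ xs) ys _    = [] , [] , refl , minimum _ , minimum _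
map-⊆-++⁻ g (z ∷ Z) (x ∷ xs) ys (.x ∷ʳ z∷Z⊆) with map-⊆-++⁻ g (z ∷ Z) xs ys z∷Z⊆
... | Zx , Zy , Z≡ , Zx⊆ , Zy⊆ = Zx , Zy , Z≡ , x ∷ʳ Zx⊆ , Zy⊆
map-⊆-++⁻ g (z ∷ Z) (x ∷ xs) ys (gz≡x ∷ Z⊆) with map-⊆-++⁻ g Z xs ys Z⊆
... | Zx , Zy , Z≡ , Zx⊆ , Zy⊆ = z ∷ Zx , Zy , cong (z ∷_) Z≡ , gz≡x ∷ Zx⊆ , Zy⊆

⊆-revFactorWith : (f : A → A) {h : E → E} (g : E → A) → (∀ e → g (h e) ≡ f (g e)) →
  ∀ {i j w} (Z : List E) → i ≤ j → map g Z ⊆ w →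
  ∃[ Za ] ∃[ Zb ] ∃[ Zc ] Z ≡ Za ++ Zb ++ Zc ×
    map g (Za ++ reverse (map h Zb) ++ Zc) ⊆ revFactorWith f i j w
⊆-revFactorWith f g gh {i} {j} {w} Z i≤j Z⊆w
  with map-⊆-++⁻ g Z (take i w) _ (subst (map g Z ⊆_) (sym (factor-decomposition w i≤j)) Z⊆w)
... | Za , Zr , refl , Za⊆ , Zr⊆
  with map-⊆-++⁻ g Zr (take (suc (j ∸ i)) (drop i w)) (drop (suc j) w) Zr⊆
... | Zb , Zc , refl , Zb⊆ , Zc⊆ =
  Za , Zb , Zc , refl ,
  subst (_⊆ revFactorWith f i j w) (sym (map-++-reverse-map g gh Za Zb Zc))
    (Sublist.++⁺ Za⊆ (Sublist.++⁺ (Sublist.reverse⁺ (Sublist.map⁺ f Zb⊆)) Zc⊆))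

map-revFactorWith : {f : A → A} {f′ : B → B} (g : A → B) → (∀ a → g (f a) ≡ f′ (g a)) →
  ∀ i j w → map g (revFactorWith f i j w) ≡ revFactorWith f′ i j (map g w)
map-revFactorWith {f′ = f′} g gf i j w = begin
    map g (revFactorWith _ i j w)
  ≡⟨ map-++-reverse-map g gf (take i w) (take n (drop i w)) (drop (suc j) w) ⟩
    map g (take i w) ++ reverse (map f′ (map g (take n (drop i w)))) ++ map g (drop (suc j) w)
  ≡⟨ sym (cong₂ _++_ (take-map i w)
           (cong₂ (λ m d → reverse (map f′ m) ++ d) middle (drop-map (suc j) w))) ⟩
    revFactorWith f′ i j (map g w) ∎
  where
  open ≡-Reasoning
  n = suc (j ∸ i)
  middle : take n (drop i (map g w)) ≡ map g (take n (drop i w))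
  middle = trans (cong (take n) (drop-map i w)) (take-map n (drop i w))

module _ {rvA : ℕ → ℕ → List A → List A} {sortedA : List A → Set}
         {rvB : ℕ → ℕ → List B → List B} {sortedB : List B → Set}
         (g : A → B) (map-rv : ∀ i j w → map g (rvA i j w) ≡ rvB i j (map g w)) where

  sortable-map⁺ : (∀ {w} → sortedA w → sortedB (map g w)) →
                  ∀ {w} → Sortable rvA sortedA k w → Sortable rvB sortedB k (map g w)
  sortable-map⁺ sorted⁺ (done w-sorted) = done (sorted⁺ w-sorted)
  sortable-map⁺ sorted⁺ {w} (step i j i≤j j<∣w∣ rest) =
    step i j i≤j (subst (j <_) (sym (length-map g w)) j<∣w∣)
      (subst (Sortable rvB sortedB _) (map-rv i j w) (sortable-map⁺ sorted⁺ rest))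

  sortable-map⁻ : (∀ {w} → sortedB (map g w) → sortedA w) →
                  ∀ {w} → Sortable rvB sortedB k (map g w) → Sortable rvA sortedA k w
  sortable-map⁻ sorted⁻ (done w-sorted) = done (sorted⁻ w-sorted)
  sortable-map⁻ sorted⁻ {w} (step i j i≤j j<∣w∣ rest) =
    step i j i≤j (subst (j <_) (length-map g w) j<∣w∣)
      (sortable-map⁻ sorted⁻ (subst (Sortable rvB sortedB _) (sym (map-rv i j w)) rest))

Increasing : List ℕ → Set
Increasing = AllPairs _<_

IsIdPerm : List ℕ → Set
IsIdPerm w = w ≡ idPerm (length w)

length-idPerm : ∀ n → length (idPerm n) ≡ n
length-idPerm n = trans (length-map suc (upTo n)) (length-upTo n)

idPerm-increasing : ∀ n → Increasing (idPerm n)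
idPerm-increasing n = AllPairsP.map⁺ (AllPairsP.applyUpTo⁺₁ (λ i → i) n (λ i<j _ → s≤s i<j))

↭-increasing-unique : ∀ {xs ys} → Increasing xs → Increasing ys → xs ↭ ys → xs ≡ ys
↭-increasing-unique xs↗ ys↗ xs↭ys =
  Pointwise-≡⇒≡ (↗↭↗⇒≋ ≤-totalOrder (sorted xs↗) (sorted ys↗) (↭⇒↭ₛ xs↭ys))
  where
  sorted : ∀ {zs} → Increasing zs → Sorted ≤-totalOrder zs
  sorted zs↗ = AllPairs⇒Sorted ≤-totalOrder (AllPairs.map <⇒≤ zs↗)

AllPairs-resp-⊆ : ∀ {R : A → A → Set} {xs ys} → xs ⊆ ys → AllPairs R ys → AllPairs R xs
AllPairs-resp-⊆ []            []          = []
AllPairs-resp-⊆ (y ∷ʳ xs⊆ys)  (_ ∷ R-ys)  = AllPairs-resp-⊆ xs⊆ys R-ys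
AllPairs-resp-⊆ (refl ∷ xs⊆ys) (R-y ∷ R-ys) =
  Sublist.All-resp-⊆ xs⊆ys R-y ∷ AllPairs-resp-⊆ xs⊆ys R-ys

Pointwise-map⇒All : ∀ {R : A → B → Set} (L : List (A × B)) →
  Pointwise R (map proj₁ L) (map proj₂ L) → All (λ p → R (proj₁ p) (proj₂ p)) L
Pointwise-map⇒All []      []        = []
Pointwise-map⇒All (p ∷ L) (r ∷ rs) = r ∷ Pointwise-map⇒All L rs

Pointwise-unzip : ∀ {R : A → B → Set} {xs ys} → Pointwise R xs ys →
  ∃[ L ] map proj₁ L ≡ xs × map proj₂ L ≡ ys × All (λ p → R (proj₁ p) (proj₂ p)) L
Pointwise-unzip [] = [] , refl , refl , []
Pointwise-unzip (_∷_ {x} {y} r rs) with Pointwise-unzip rs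
... | L , refl , refl , R-L = (x , y) ∷ L , refl , refl , r ∷ R-L

SameOrder : ℕ × ℕ → ℕ × ℕ → Set
SameOrder (x , y) (x′ , y′) = ((x < x′) ⇔ (y < y′)) × ((x′ < x) ⇔ (y′ < y))

SameOrder-sym : ∀ {p q} → SameOrder p q → SameOrder q p
SameOrder-sym (p<q , q<p) = q<p , p<q

OrdIso⇒SameOrder : (L : List (ℕ × ℕ)) → OrdIso (map proj₁ L) (map proj₂ L) → AllPairs SameOrder L
OrdIso⇒SameOrder []      []           = []
OrdIso⇒SameOrder (p ∷ L) (p~L ∷ iso) = Pointwise-map⇒All L p~L ∷ OrdIso⇒SameOrder L iso

SameOrder-increasing : ∀ {L} → AllPairs SameOrder L →
                       Increasing (map proj₂ L) → Increasing (map proj₁ L)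
SameOrder-increasing {[]}    []           []          = []
SameOrder-increasing {p ∷ L} (p~L ∷ same) (p<L ∷ inc) =
  AllP.map⁺ (All.zipWith (λ (p~q , p<q) → Equivalence.from (proj₁ p~q) p<q) (p~L , AllP.map⁻ p<L))
  ∷ SameOrder-increasing same inc

-- Pairs (pattern value, text value) of an order-isomorphism whose pattern side is a permutation.
OrderIsoPerm : List (ℕ × ℕ) → Set
OrderIsoPerm L = AllPairs SameOrder L × ∃[ n ] map proj₁ L ↭ idPerm n

OrderIsoPerm-resp-↭ : ∀ {L L′} → L ↭ L′ → OrderIsoPerm L → OrderIsoPerm L′
OrderIsoPerm-resp-↭ L↭L′ (same , n , perm) =
  SetoidPerm.AllPairs-resp-↭ (setoid _) SameOrder-sym (resp₂ SameOrder) (↭⇒↭ₛ L↭L′) same ,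
  n , ↭-trans (↭-sym (Perm.map⁺ proj₁ L↭L′)) perm

OrderIsoPerm-idPerm : ∀ {L} → OrderIsoPerm L → Increasing (map proj₂ L) → IsIdPerm (map proj₁ L)
OrderIsoPerm-idPerm (same , n , perm) inc = trans L≡id (cong idPerm (sym length≡n))
  where
  L≡id = ↭-increasing-unique (SameOrder-increasing same inc) (idPerm-increasing n) perm
  length≡n = trans (cong length L≡id) (length-idPerm n)

PegEntry : Set
PegEntry = ℕ × Deco

flipEntry : PegEntry → PegEntry
flipEntry (v , d) = v , flip d

flipPair : PegEntry × PegEntry → PegEntry × PegEntry
flipPair (s , t) = flipEntry s , flipEntry t

values : PegEntry × PegEntry → ℕ × ℕ
values (s , t) = proj₁ s , proj₁ t

DecoCompatible : PegEntry × PegEntry → Set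
DecoCompatible (s , t) = DecoOK (proj₂ s) (proj₂ t)

-- Z lists the pairs (pattern entry, text entry) of an occurrence.
Occurrence : List (PegEntry × PegEntry) → Set
Occurrence Z = OrderIsoPerm (map values Z) × All DecoCompatible Z

proj₁-values : (Z : List (PegEntry × PegEntry)) → map proj₁ (map values Z) ≡ map proj₁ (map proj₁ Z)
proj₁-values Z = trans (sym (map-∘ Z)) (map-∘ Z)

proj₂-values : (Z : List (PegEntry × PegEntry)) → map proj₂ (map values Z) ≡ map proj₁ (map proj₂ Z)
proj₂-values Z = trans (sym (map-∘ Z)) (map-∘ Z)

DecoOK-flip : ∀ {d e} → DecoOK d e → DecoOK (flip d) (flip e)
DecoOK-flip {plus}  refl = refl
DecoOK-flip {minus} refl = refl
DecoOK-flip {dot}   _    = refl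

DecoOK-≢minus : ∀ {d e} → DecoOK d e → e ≢ minus → d ≢ minus
DecoOK-≢minus {plus}  _    _      ()
DecoOK-≢minus {minus} refl e≢minus = e≢minus
DecoOK-≢minus {dot}   _    _      ()

Occurrence-reverse : ∀ Za Zb Zc → Occurrence (Za ++ Zb ++ Zc) →
                     Occurrence (Za ++ reverse (map flipPair Zb) ++ Zc)
Occurrence-reverse Za Zb Zc (iso , compatible) =
  OrderIsoPerm-resp-↭ (↭-sym values↭) iso , Perm.All-resp-↭ (↭-sym reversed) flipped-compatible
  where
  reversed : Za ++ reverse (map flipPair Zb) ++ Zc ↭ Za ++ map flipPair Zb ++ Zc
  reversed = Perm.++⁺ˡ Za (Perm.++⁺ʳ Zc (Perm.↭-reverse (map flipPair Zb)))
  values↭ : map values (Za ++ reverse (map flipPair Zb) ++ Zc) ↭ map values (Za ++ Zb ++ Zc)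
  values↭ = ↭-trans (Perm.map⁺ values reversed) (↭-reflexive (begin
      map values (Za ++ map flipPair Zb ++ Zc)
    ≡⟨ map-++₃ values Za (map flipPair Zb) Zc ⟩
      map values Za ++ map values (map flipPair Zb) ++ map values Zc
    ≡⟨ cong (λ m → map values Za ++ m ++ map values Zc) (sym (map-∘ Zb)) ⟩
      map values Za ++ map values Zb ++ map values Zc
    ≡⟨ sym (map-++₃ values Za Zb Zc) ⟩
      map values (Za ++ Zb ++ Zc) ∎))
    where open ≡-Reasoning
  flipped-compatible : All DecoCompatible (Za ++ map flipPair Zb ++ Zc)
  flipped-compatible with AllP.++⁻ Za compatible
  ... | Za-ok , Zbc-ok with AllP.++⁻ Zb Zbc-ok
  ... | Zb-ok , Zc-ok = AllP.++⁺ Za-ok (AllP.++⁺ (AllP.map⁺ (All.map DecoOK-flip Zb-ok)) Zc-ok)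

Occurrence-sorted : ∀ {τ Z} → PegSorted τ → map proj₂ Z ⊆ τ → Occurrence Z → PegSorted (map proj₁ Z)
Occurrence-sorted {Z = Z} (τ-id , τ-signs) Z⊆τ (iso , compatible) =
  trans σ-id (cong idPerm (length-map proj₁ (map proj₁ Z))) , σ-signs
  where
  text-increasing : Increasing (map proj₂ (map values Z))
  text-increasing = subst Increasing (sym (proj₂-values Z))
    (AllPairs-resp-⊆ (Sublist.map⁺ proj₁ Z⊆τ) (subst Increasing (sym τ-id) (idPerm-increasing _)))
  σ-id : IsIdPerm (map proj₁ (map proj₁ Z))
  σ-id = subst IsIdPerm (proj₁-values Z) (OrderIsoPerm-idPerm iso text-increasing)
  σ-signs : All (λ e → proj₂ e ≢ minus) (map proj₁ Z)
  σ-signs = AllP.map⁺ (All.zipWith (λ (ok , ≢minus) → DecoOK-≢minus ok ≢minus)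
                        (compatible , AllP.map⁻ (Sublist.All-resp-⊆ Z⊆τ τ-signs)))

InBhat-occurrence : ∀ {τ} (Z : List (PegEntry × PegEntry)) → map proj₂ Z ⊆ τ → Occurrence Z →
                    InBhat k τ → InBhat k (map proj₁ Z)
InBhat-occurrence Z Z⊆τ occ (done τ-sorted) = done (Occurrence-sorted τ-sorted Z⊆τ occ)
InBhat-occurrence Z Z⊆τ occ (step i j i≤j _ rest)
  with ⊆-revFactorWith flipEntry proj₂ (λ _ → refl) Z i≤j Z⊆τ
... | Za , Zb , Zc , refl , Z′⊆ =
  subst (InBhat _) (sym (map-++₃ proj₁ Za Zb Zc))
    (sortable-suc-reversal flipEntry (map proj₁ Za) (map proj₁ Zb) (map proj₁ Zc)
      (subst (InBhat _) (map-++-reverse-map proj₁ (λ _ → refl) Za Zb Zc)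
        (InBhat-occurrence _ Z′⊆ (Occurrence-reverse Za Zb Zc occ) rest)))

InBhat-pattern : ∀ {σ τ} → IsPegPerm σ → IsPegPattern σ τ → InBhat k τ → InBhat k σ
InBhat-pattern σ-perm (ρ , ρ⊆τ , iso , compatible) τ∈B with Pointwise-unzip compatible
... | Z , refl , refl , Z-compatible =
  InBhat-occurrence Z ρ⊆τ ((same-order , _ , values-perm) , Z-compatible) τ∈B
  where
  values-perm : map proj₁ (map values Z) ↭ idPerm (length (map proj₁ (map proj₁ Z)))
  values-perm = subst (_↭ idPerm (length (map proj₁ (map proj₁ Z)))) (sym (proj₁-values Z)) σ-perm
  same-order : AllPairs SameOrder (map values Z)
  same-order = OrdIso⇒SameOrder (map values Z)
                 (subst₂ OrdIso (sym (proj₁-values Z)) (sym (proj₂-values Z)) iso)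

dotted : List ℕ → Peg
dotted = map (_, dot)

proj₁-dotted : (w : List ℕ) → map proj₁ (dotted w) ≡ w
proj₁-dotted w = trans (sym (map-∘ w)) (map-id w)

dotted-revFactor : ∀ i j w → map (_, dot) (revFactor i j w) ≡ revPeg i j (dotted w)
dotted-revFactor = map-revFactorWith (_, dot) (λ _ → refl)

InB⇒InBhat-dotted : ∀ {w} → InB k w → InBhat k (dotted w)
InB⇒InBhat-dotted = sortable-map⁺ (_, dot) dotted-revFactor sorted⁺
  where
  sorted⁺ : ∀ {w} → IsIdPerm w → PegSorted (dotted w)
  sorted⁺ {w} w-id = trans (proj₁-dotted w) (trans w-id (cong idPerm (sym (length-map _ w)))) ,
                     AllP.map⁺ (All.universal (λ _ ()) w)

InBhat-dotted⇒InB : ∀ {w} → InBhat k (dotted w) → InB k w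
InBhat-dotted⇒InB = sortable-map⁻ (_, dot) dotted-revFactor sorted⁻
  where
  sorted⁻ : ∀ {w} → PegSorted (dotted w) → IsIdPerm w
  sorted⁻ {w} (w-id , _) = trans (sym (proj₁-dotted w)) (trans w-id (cong idPerm (length-map _ w)))

dotted-compatible : ∀ {xs ys} → OrdIso xs ys →
  Pointwise (λ s r → DecoOK (proj₂ s) (proj₂ r)) (dotted xs) (dotted ys)
dotted-compatible []        = []
dotted-compatible (_ ∷ iso) = refl ∷ dotted-compatible iso

dotted-pattern : ∀ {σ τ} → IsPattern σ τ → IsPegPattern (dotted σ) (dotted τ)
dotted-pattern (ρ , ρ⊆τ , iso) =
  dotted ρ , Sublist.map⁺ _ ρ⊆τ ,
  subst₂ OrdIso (sym (proj₁-dotted _)) (sym (proj₁-dotted ρ)) iso , dotted-compatible iso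

InB-pattern : ∀ {σ τ} → IsPerm σ → IsPattern σ τ → InB k τ → InB k σ
InB-pattern {σ = σ} σ-perm σ≼τ τ∈B =
  InBhat-dotted⇒InB (InBhat-pattern (subst IsPerm (sym (proj₁-dotted σ)) σ-perm)
                                    (dotted-pattern σ≼τ) (InB⇒InBhat-dotted τ∈B))

-- Neither part needs τ to be a permutation.
mainTheorem10 :
    ((k : ℕ) (σ τ : List ℕ) → IsPerm σ → IsPerm τ →
       IsPattern σ τ → InB k τ → InB k σ)
    ×
    ((k : ℕ) (σ τ : Peg) → IsPegPerm σ → IsPegPerm τ →
       IsPegPattern σ τ → InBhat k τ → InBhat k σ)
mainTheorem10 = (λ _ _ _ σ-perm _ → InB-pattern σ-perm) , (λ _ _ _ σ-perm _ → InBhat-pattern σ-perm)
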